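{- Let $x:\mathbb{N}_+\to\mathbb{N}$ be non-decreasing and $n\ge1$. Then $$\mathrm{ch}(\mathrm{PF}_n(x))=\sum_{\pi\models n}\gamma_\pi S^\pi,\qquad \gamma_\pi=\sum_{\tau\models\ell(\pi)}\ \prod_{i=1}^{\ell(\tau)}\binom{\Psi_\tau(x;\pi,i)}{\tau_i},$$ where for a composition $\pi$ of $n$ and a composition $\tau$ of $\ell(\pi)$, $\Psi_\tau(x;\pi,1)=x(1)$ and $\Psi_\tau(x;\pi,i)=x\big(1+\pi(\tau(i-1))\big)-x\big(1+\pi(\tau(i-2))\big)$ for $2\le i\le \ell(\tau)$.
   Context: $\mathbf{Sym}$ is the free associative algebra over $\mathbb{C}$ on $S_1,S_2,\dots$; $S^\pi=S_{\pi_1}\cdots S_{\pi_k}$. For a composition $\pi$, $\ell(\pi)$ is its number of parts and $\pi(j)=\pi_1+\dots+\pi_j$, $\pi(0)=0$ (same for $\tau$). An $x$-parking function on $[n]$ is a sequence $(Q_i)_{i\ge1}$ of pairwise disjoint subsets of $[n]$ with union $[n]$ and $\sum_{i\le x(k)}|Q_i|\ge k$ for $1\le k\le n$. $\mathrm{ch}(\mathrm{PF}_n(x)):=\sum_d S^{\pi(d)}$, summed over sequences $d=(d_i)_{i\ge1}$ of non-negative integers with $\sum d_i=n$ and $\sum_{i\le x(k)}d_i\ge k$ for all $1\le k\le n$, where $\pi(d)$ is obtained from $d$ by deleting zeros; this is the non-commutative Frobenius characteristic of the $H_n(0)$-module spanned by $x$-parking functions on $[n]$ (with $T_i$ acting by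 $Q\mapsto\sigma_i(Q)$, $0$ or $-Q$ according as the block index of $i$ is smaller than, equal to, or larger than that of $i+1$). -}

module Defs where

open import Data.Nat using (ℕ; zero; suc; _+_; _*_; _∸_; _≤_; _≡ᵇ_; _≤ᵇ_)
open import Data.Nat.Combinatorics using (_C_)
open import Data.Bool using (Bool; true; false; _∧_; if_then_else_)
open import Data.List using (List; []; _∷_; [_]; map; take; length; upTo; concatMap; _++_)
open import Data.Nat.ListAction using (sum; product)
open import Data.Bool.ListAction using (and)
open import Data.List.Relation.Unary.All using (All)
open import Relation.Binary.PropositionalEquality using (_≡_)
open import Relation.Nullary.Decidable using (⌊_⌋)
import Data.List.Properties as LP
open import Data.Nat.Properties using (_≟_)

-- Compositions are represented as lists of positive naturals (All (1 ≤_) π).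

-- Prefix sums: psum π j = π(j) = π₁ + … + π_j  (psum π 0 = 0).
psum : List ℕ → ℕ → ℕ
psum π j = sum (take j π)

at : List ℕ → ℕ → ℕ
at []       _       = 0
at (a ∷ _)  zero    = a
at (_ ∷ as) (suc j) = at as j

incHead : List ℕ → List ℕ
incHead []      = []
incHead (a ∷ l) = suc a ∷ l

compositions : ℕ → List (List ℕ)
compositions zero          = [ [] ]
compositions (suc zero)    = [ 1 ∷ [] ]
compositions (suc (suc m)) =
  map (1 ∷_) (compositions (suc m)) ++ map incHead (compositions (suc m))

-- Ψ_τ(x; π, i) for i ≥ 1 (value at i = 0 is irrelevant).
Ψ : (ℕ → ℕ) → List ℕ → List ℕ → ℕ → ℕ
Ψ x τ π zero                = 0
Ψ x τ π (suc zero)          = x 1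
Ψ x τ π (suc (suc k))       =
  x (1 + psum π (psum τ (suc k))) ∸ x (1 + psum π (psum τ k))

γ : (ℕ → ℕ) → List ℕ → ℕ
γ x π = sum (map (λ τ → product (map (λ j → Ψ x τ π (suc j) C at τ j)
                                     (upTo (length τ))))
                 (compositions (length π)))

deleteZeros : List ℕ → List ℕ
deleteZeros []            = []
deleteZeros (zero ∷ d)    = deleteZeros d
deleteZeros (suc a ∷ d)   = suc a ∷ deleteZeros d

lists : ℕ → ℕ → List (List ℕ)
lists zero    m = [ [] ]
lists (suc L) m = concatMap (λ a → map (a ∷_) (lists L m)) (upTo (suc m))

count : {A : Set} → (A → Bool) → List A → ℕ
count p []      = 0
count p (a ∷ l) = (if p a then 1 else 0) + count p l

-- The defining condition of the sequences d (d given by its first x(n) entries;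
-- all later entries are forced to be 0 by the condition at k = n).
-- sum d = n and Σ_{i ≤ x(k)} d_i ≥ k for 1 ≤ k ≤ n.
admissible : (ℕ → ℕ) → ℕ → List ℕ → Bool
admissible x n d =
  (sum d ≡ᵇ n) ∧ and (map (λ j → suc j ≤ᵇ psum d (x (suc j))) (upTo n))

-- Coefficient of S^π in ch(PF_n(x)) = Σ_d S^{π(d)}, i.e. #{d admissible : π(d) = π}.
chPF : (ℕ → ℕ) → ℕ → List ℕ → ℕ
chPF x n π =
  count (λ d → admissible x n d ∧ ⌊ LP.≡-dec _≟_ (deleteZeros d) π ⌋)
        (lists (x n) n)

-- Coefficient of S^π on the right-hand side Σ_{π ⊨ n} γ_π S^π.
rhs : (ℕ → ℕ) → ℕ → List ℕ → ℕ
rhs x n π = if sum π ≡ᵇ n then γ x π else 0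

NonDecreasing : (ℕ → ℕ) → Set
NonDecreasing x = ∀ {i j} → 1 ≤ i → i ≤ j → x i ≤ x j

-- Split an admissible sequence d after its first x(1) entries.  Their nonzero
-- entries form a prefix π₁ … π_t of π, nonempty by the condition at k = 1, and
-- binom(x(1), t) words have this property; the rest of d is then exactly an
-- admissible sequence for π_{t+1} … and the shifted function
-- k ↦ x(π(t) + k) − x(1).  Expanding γ_π according to the first part t = τ₁ of τ
-- gives the same recursion, γ_π = Σ_t binom(x(1), t) γ_{π_{>t}} for the shifted
-- function, so both sides agree by induction on ℓ(π).

module Submission where

open import Defs
open import Algebra.Properties.CommutativeSemigroup using (interchange)
open import Data.Bool using (Bool; true; false; T; _∧_)
open import Data.Bool.ListAction using (all)
open import Data.Bool.Properties using (T-∧)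
open import Data.List using (List; []; _∷_; _++_; map; take; drop; length; upTo; applyUpTo; concatMap)
import Data.List.Properties as List
open import Data.List.Relation.Unary.All using (All; []; _∷_)
import Data.List.Relation.Unary.All as All
open import Data.List.Relation.Unary.All.Properties using (all⁺; all⁻; applyUpTo⁺₁; applyUpTo⁻; take⁺; drop⁺)
open import Data.Nat using (ℕ; zero; suc; _+_; _*_; _∸_; _≤_; _<_; _≡ᵇ_; _≤ᵇ_; z≤n; s≤s; s≤s⁻¹)
open import Data.Nat.Combinatorics using (_C_; nCk+nC[k+1]≡[n+1]C[k+1])
open import Data.Nat.ListAction using (sum; product)
open import Data.Nat.ListAction.Properties using (sum-++)
open import Data.Nat.Properties
open import Data.Product using (_×_; _,_; proj₁; proj₂; uncurry)
open import Data.Unit using (tt)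
open import Function using (_∘_; id; _⇔_; mk⇔; Equivalence)
open import Relation.Binary.PropositionalEquality
open import Relation.Nullary using (¬_; Dec; yes; no; contradiction)
open import Relation.Nullary.Decidable using (⌊_⌋; T?; _×-dec_; toWitness; fromWitness)
import Relation.Nullary.Decidable as Dec

private
  variable
    A P Q : Set

infix 4 _≟ₗ_
_≟ₗ_ : (u v : List ℕ) → Dec (u ≡ v)
_≟ₗ_ = List.≡-dec _≟_

𝟙 : Dec P → ℕ
𝟙 (yes _) = 1
𝟙 (no _)  = 0

𝟙-cong : (P → Q) → (Q → P) → (p : Dec P) (q : Dec Q) → 𝟙 p ≡ 𝟙 q
𝟙-cong f g (yes _)  (yes _)  = refl
𝟙-cong f g (yes p)  (no ¬q)  = contradiction (f p) ¬q
𝟙-cong f g (no ¬p)  (yes q)  = contradiction (g q) ¬p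
𝟙-cong f g (no _)   (no _)   = refl

𝟙-¬ : ¬ P → (p : Dec P) → 𝟙 p ≡ 0
𝟙-¬ ¬p (yes p) = contradiction p ¬p
𝟙-¬ ¬p (no _)  = refl

𝟙-× : (p : Dec P) (q : Dec Q) → 𝟙 (p ×-dec q) ≡ 𝟙 p * 𝟙 q
𝟙-× (yes _) (yes _) = refl
𝟙-× (yes _) (no _)  = refl
𝟙-× (no _)  _       = refl

∑ : (A → ℕ) → List A → ℕ
∑ f xs = sum (map f xs)

∑< : ℕ → (ℕ → ℕ) → ℕ
∑< zero    g = 0
∑< (suc m) g = g 0 + ∑< m (g ∘ suc)

count≡∑𝟙 : (p : A → Bool) (xs : List A) → count p xs ≡ ∑ (λ a → 𝟙 (T? (p a))) xs
count≡∑𝟙 p []       = refl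
count≡∑𝟙 p (a ∷ xs) with p a
... | true  = cong suc (count≡∑𝟙 p xs)
... | false = count≡∑𝟙 p xs

∑-cong : ∀ {f g : A → ℕ} xs → (∀ a → f a ≡ g a) → ∑ f xs ≡ ∑ g xs
∑-cong []       _  = refl
∑-cong (a ∷ xs) eq = cong₂ _+_ (eq a) (∑-cong xs eq)

∑-0 : ∀ {f : A → ℕ} xs → (∀ a → f a ≡ 0) → ∑ f xs ≡ 0
∑-0 []       _  = refl
∑-0 (a ∷ xs) eq = cong₂ _+_ (eq a) (∑-0 xs eq)

∑-++ : ∀ (f : A → ℕ) xs ys → ∑ f (xs ++ ys) ≡ ∑ f xs + ∑ f ys
∑-++ f xs ys = trans (cong sum (List.map-++ f xs ys)) (sum-++ (map f xs) (map f ys))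

∑-map : ∀ {B : Set} (f : B → ℕ) (g : A → B) xs → ∑ f (map g xs) ≡ ∑ (f ∘ g) xs
∑-map f g xs = cong sum (sym (List.map-∘ xs))

∑-concatMap : ∀ {B : Set} (f : B → ℕ) (g : A → List B) xs →
  ∑ f (concatMap g xs) ≡ ∑ (λ a → ∑ f (g a)) xs
∑-concatMap f g []       = refl
∑-concatMap f g (a ∷ xs) =
  trans (∑-++ f (g a) (concatMap g xs)) (cong (∑ f (g a) +_) (∑-concatMap f g xs))

∑-applyUpTo : ∀ (f : A → ℕ) (g : ℕ → A) m → ∑ f (applyUpTo g m) ≡ ∑< m (f ∘ g)
∑-applyUpTo f g zero    = refl
∑-applyUpTo f g (suc m) = cong (f (g 0) +_) (∑-applyUpTo f (g ∘ suc) m)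

∑-*ˡ : ∀ c (f : A → ℕ) xs → ∑ (λ a → c * f a) xs ≡ c * ∑ f xs
∑-*ˡ c f []       = sym (*-zeroʳ c)
∑-*ˡ c f (a ∷ xs) = trans (cong (c * f a +_) (∑-*ˡ c f xs)) (sym (*-distribˡ-+ c (f a) _))

∑-∑-* : ∀ {B : Set} {f : A → ℕ} {g : B → ℕ} xs ys →
  ∑ (λ a → ∑ (λ b → f a * g b) ys) xs ≡ ∑ f xs * ∑ g ys
∑-∑-* []           ys = refl
∑-∑-* {f = f} {g} (a ∷ xs) ys = begin
  ∑ (λ b → f a * g b) ys + ∑ (λ a → ∑ (λ b → f a * g b) ys) xs
    ≡⟨ cong₂ _+_ (∑-*ˡ (f a) g ys) (∑-∑-* xs ys) ⟩
  f a * ∑ g ys + ∑ f xs * ∑ g ys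
    ≡⟨ sym (*-distribʳ-+ (∑ g ys) (f a) _) ⟩
  (f a + ∑ f xs) * ∑ g ys ∎
  where open ≡-Reasoning

∑<-cong : ∀ m {f g : ℕ → ℕ} → (∀ {j} → j < m → f j ≡ g j) → ∑< m f ≡ ∑< m g
∑<-cong zero    _  = refl
∑<-cong (suc m) eq = cong₂ _+_ (eq (s≤s z≤n)) (∑<-cong m (eq ∘ s≤s))

∑<-0 : ∀ m {g : ℕ → ℕ} → (∀ {j} → j < m → g j ≡ 0) → ∑< m g ≡ 0
∑<-0 zero    _  = refl
∑<-0 (suc m) eq = cong₂ _+_ (eq (s≤s z≤n)) (∑<-0 m (eq ∘ s≤s))

∑<-single : ∀ m {g : ℕ → ℕ} {i} → i < m → (∀ {j} → j < m → j ≢ i → g j ≡ 0) → ∑< m g ≡ g i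
∑<-single (suc m) {i = zero} _ eq =
  trans (cong (_ +_) (∑<-0 m (λ j<m → eq (s≤s j<m) λ ()))) (+-identityʳ _)
∑<-single (suc m) {i = suc i} (s≤s i<m) eq =
  cong₂ _+_ (eq (s≤s z≤n) λ ()) (∑<-single m i<m (λ j<m j≢i → eq (s≤s j<m) (j≢i ∘ suc-injective)))

∑<-+ : ∀ m (f g : ℕ → ℕ) → ∑< m (λ j → f j + g j) ≡ ∑< m f + ∑< m g
∑<-+ zero    f g = refl
∑<-+ (suc m) f g = trans (cong (f 0 + g 0 +_) (∑<-+ m (f ∘ suc) (g ∘ suc)))
                         (interchange +-commutativeSemigroup (f 0) (g 0) _ _)

∑-∑< : ∀ m (g : A → ℕ → ℕ) xs → ∑ (λ a → ∑< m (g a)) xs ≡ ∑< m (λ j → ∑ (λ a → g a j) xs)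
∑-∑< m g []       = sym (∑<-0 m {λ _ → 0} (λ _ → refl))
∑-∑< m g (a ∷ xs) =
  trans (cong (∑< m (g a) +_) (∑-∑< m g xs)) (sym (∑<-+ m (g a) (λ j → ∑ (λ a → g a j) xs)))

-- Words over {0, …, M}

∑-lists-suc : ∀ (f : List ℕ → ℕ) L M →
  ∑ f (lists (suc L) M) ≡ ∑< (suc M) (λ a → ∑ (λ d → f (a ∷ d)) (lists L M))
∑-lists-suc f L M = begin
  ∑ f (concatMap (λ a → map (a ∷_) (lists L M)) (upTo (suc M)))
    ≡⟨ ∑-concatMap f (λ a → map (a ∷_) (lists L M)) (upTo (suc M)) ⟩
  ∑ (λ a → ∑ f (map (a ∷_) (lists L M))) (upTo (suc M))
    ≡⟨ ∑-cong (upTo (suc M)) (λ a → ∑-map f (a ∷_) (lists L M)) ⟩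
  ∑ (λ a → ∑ (λ d → f (a ∷ d)) (lists L M)) (upTo (suc M))
    ≡⟨ ∑-applyUpTo _ id (suc M) ⟩
  ∑< (suc M) (λ a → ∑ (λ d → f (a ∷ d)) (lists L M)) ∎
  where open ≡-Reasoning

∑-lists-cong : ∀ L M {f g : List ℕ → ℕ} → (∀ d → length d ≡ L → f d ≡ g d) →
  ∑ f (lists L M) ≡ ∑ g (lists L M)
∑-lists-cong zero    M eq = cong (_+ 0) (eq [] refl)
∑-lists-cong (suc L) M {f} {g} eq = begin
  ∑ f (lists (suc L) M)
    ≡⟨ ∑-lists-suc f L M ⟩
  ∑< (suc M) (λ a → ∑ (λ d → f (a ∷ d)) (lists L M))
    ≡⟨ ∑<-cong (suc M) (λ {a} _ → ∑-lists-cong L M (λ d len → eq (a ∷ d) (cong suc len))) ⟩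
  ∑< (suc M) (λ a → ∑ (λ d → g (a ∷ d)) (lists L M))
    ≡⟨ sym (∑-lists-suc g L M) ⟩
  ∑ g (lists (suc L) M) ∎
  where open ≡-Reasoning

∑-lists-+ : ∀ L₁ L₂ M (f : List ℕ → ℕ) →
  ∑ f (lists (L₁ + L₂) M) ≡ ∑ (λ d₁ → ∑ (λ d₂ → f (d₁ ++ d₂)) (lists L₂ M)) (lists L₁ M)
∑-lists-+ zero     L₂ M f = sym (+-identityʳ _)
∑-lists-+ (suc L₁) L₂ M f = begin
  ∑ f (lists (suc (L₁ + L₂)) M)
    ≡⟨ ∑-lists-suc f (L₁ + L₂) M ⟩
  ∑< (suc M) (λ a → ∑ (λ d → f (a ∷ d)) (lists (L₁ + L₂) M))
    ≡⟨ ∑<-cong (suc M) (λ {a} _ → ∑-lists-+ L₁ L₂ M (λ d → f (a ∷ d))) ⟩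
  ∑< (suc M) (λ a → ∑ (λ d₁ → ∑ (λ d₂ → f (a ∷ d₁ ++ d₂)) (lists L₂ M)) (lists L₁ M))
    ≡⟨ sym (∑-lists-suc (λ d₁ → ∑ (λ d₂ → f (d₁ ++ d₂)) (lists L₂ M)) L₁ M) ⟩
  ∑ (λ d₁ → ∑ (λ d₂ → f (d₁ ++ d₂)) (lists L₂ M)) (lists (suc L₁) M) ∎
  where open ≡-Reasoning

Composition≤ : ℕ → List ℕ → Set
Composition≤ M σ = All (λ a → 1 ≤ a × a ≤ M) σ

deleteZeros-++ : ∀ d₁ d₂ → deleteZeros (d₁ ++ d₂) ≡ deleteZeros d₁ ++ deleteZeros d₂
deleteZeros-++ []           d₂ = refl
deleteZeros-++ (zero ∷ d₁)  d₂ = deleteZeros-++ d₁ d₂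
deleteZeros-++ (suc a ∷ d₁) d₂ = cong (suc a ∷_) (deleteZeros-++ d₁ d₂)

sum-deleteZeros : ∀ d → sum (deleteZeros d) ≡ sum d
sum-deleteZeros []          = refl
sum-deleteZeros (zero ∷ d)  = sum-deleteZeros d
sum-deleteZeros (suc a ∷ d) = cong (suc a +_) (sum-deleteZeros d)

-- Such a word is determined by the positions of its nonzero entries.
∑-lists-deleteZeros : ∀ L M σ → Composition≤ M σ →
  ∑ (λ d → 𝟙 (deleteZeros d ≟ₗ σ)) (lists L M) ≡ L C length σ
∑-lists-deleteZeros zero    M []      _ = refl
∑-lists-deleteZeros zero    M (_ ∷ _) _ = refl
∑-lists-deleteZeros (suc L) M [] _ = trans (∑-lists-suc _ L M) (cong₂ _+_
  (∑-lists-deleteZeros L M [] [])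
  (∑<-0 M (λ {j} _ → ∑-0 (lists L M) (λ d → 𝟙-¬ (λ ()) (suc j ∷ deleteZeros d ≟ₗ [])))))
∑-lists-deleteZeros (suc L) M σ@(suc b ∷ σ′) ((_ , b<M) ∷ parts) = begin
  ∑ f (lists (suc L) M)
    ≡⟨ ∑-lists-suc f L M ⟩
  ∑ f (lists L M) + ∑< M (λ j → ∑ (λ d → f (suc j ∷ d)) (lists L M))
    ≡⟨ cong₂ _+_ (∑-lists-deleteZeros L M σ ((s≤s z≤n , b<M) ∷ parts)) (∑<-single M b<M other) ⟩
  L C length σ + ∑ (λ d → f (suc b ∷ d)) (lists L M)
    ≡⟨ cong (L C length σ +_) (trans (∑-cong (lists L M) drop-head) (∑-lists-deleteZeros L M σ′ parts)) ⟩
  L C suc (length σ′) + L C length σ′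
    ≡⟨ +-comm (L C suc (length σ′)) _ ⟩
  L C length σ′ + L C suc (length σ′)
    ≡⟨ nCk+nC[k+1]≡[n+1]C[k+1] L (length σ′) ⟩
  suc L C length σ ∎
  where
  open ≡-Reasoning
  f : List ℕ → ℕ
  f d = 𝟙 (deleteZeros d ≟ₗ σ)
  other : ∀ {j} → j < M → j ≢ b → ∑ (λ d → f (suc j ∷ d)) (lists L M) ≡ 0
  other _ j≢b = ∑-0 (lists L M) (λ d → 𝟙-¬ (j≢b ∘ suc-injective ∘ List.∷-injectiveˡ) _)
  drop-head : ∀ d → f (suc b ∷ d) ≡ 𝟙 (deleteZeros d ≟ₗ σ′)
  drop-head d = 𝟙-cong List.∷-injectiveʳ (cong (suc b ∷_)) _ _

take-length-++ : ∀ (u v : List A) → take (length u) (u ++ v) ≡ u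
take-length-++ []      v = refl
take-length-++ (a ∷ u) v = cong (a ∷_) (take-length-++ u v)

drop-length-++ : ∀ (u v : List A) → drop (length u) (u ++ v) ≡ v
drop-length-++ []      v = refl
drop-length-++ (_ ∷ u) v = drop-length-++ u v

length-take-≤ : ∀ {t} (xs : List A) → t ≤ length xs → length (take t xs) ≡ t
length-take-≤ {t = t} xs t≤ = trans (List.length-take t xs) (m≤n⇒m⊓n≡m t≤)

length-≤-prefix : ∀ {t} {u xs : List A} → u ≡ take t xs → length u ≤ length xs
length-≤-prefix {t = t} {xs = xs} refl =
  subst (length (take t xs) ≤_) (cong length (List.take++drop≡id t xs)) (List.length-++-≤ˡ (take t xs))

-- Only the prefix of the right length can equal u.
∑<-prefixes : ∀ (u xs : List ℕ) (g : ℕ → ℕ) →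
  ∑< (suc (length xs)) (λ t → 𝟙 (u ≟ₗ take t xs) * g t) ≡ 𝟙 (u ≟ₗ take (length u) xs) * g (length u)
∑<-prefixes u xs g with length u ≤? length xs
... | yes u≤xs = ∑<-single (suc (length xs)) (s≤s u≤xs) (λ t<m t≢u → mismatch (s≤s⁻¹ t<m) t≢u)
  where
  mismatch : ∀ {t} → t ≤ length xs → t ≢ length u → 𝟙 (u ≟ₗ take t xs) * g t ≡ 0
  mismatch {t} t≤ t≢u =
    cong (_* g t) (𝟙-¬ (λ u≡ → t≢u (trans (sym (length-take-≤ xs t≤)) (cong length (sym u≡))))
                       (u ≟ₗ take t xs))
... | no u≰xs = trans (∑<-0 (suc (length xs)) (λ {t} _ → vanish t)) (sym (vanish (length u)))
  where
  vanish : ∀ t → 𝟙 (u ≟ₗ take t xs) * g t ≡ 0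
  vanish t = cong (_* g t) (𝟙-¬ (u≰xs ∘ length-≤-prefix {t = t}) (u ≟ₗ take t xs))

psum-+ : ∀ t r (π : List ℕ) → psum π (t + r) ≡ psum π t + psum (drop t π) r
psum-+ zero    r       π       = refl
psum-+ (suc t) zero    []      = refl
psum-+ (suc t) (suc r) []      = refl
psum-+ (suc t) r       (a ∷ π) = trans (cong (a +_) (psum-+ t r π)) (sym (+-assoc a _ _))

psum-++ : ∀ d₁ d₂ {k} → length d₁ ≤ k → psum (d₁ ++ d₂) k ≡ sum d₁ + psum d₂ (k ∸ length d₁)
psum-++ []       d₂ _         = refl
psum-++ (a ∷ d₁) d₂ (s≤s len) = trans (cong (a +_) (psum-++ d₁ d₂ len)) (sym (+-assoc a _ _))

psum-mono : ∀ d {i j} → i ≤ j → psum d i ≤ psum d j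
psum-mono d       {zero}  _         = z≤n
psum-mono []      {suc _} (s≤s _)   = ≤-refl
psum-mono (a ∷ d) {suc i} (s≤s i≤j) = +-monoʳ-≤ a (psum-mono d i≤j)

sum-take-drop : ∀ t π → sum π ≡ psum π t + sum (drop t π)
sum-take-drop t π = trans (cong sum (sym (List.take++drop≡id t π))) (sum-++ (take t π) (drop t π))

sum≡psum : ∀ d {t π} → deleteZeros d ≡ take t π → sum d ≡ psum π t
sum≡psum d dz≡ = trans (sym (sum-deleteZeros d)) (cong sum dz≡)

-- The recursion for γ

∑-compositions-suc : ∀ k (f : List ℕ → ℕ) →
  ∑ f (compositions (suc k)) ≡ ∑< (suc k) (λ j → ∑ (λ τ → f (suc j ∷ τ)) (compositions (k ∸ j)))
∑-compositions-suc zero    f = cong (_+ 0) (sym (+-identityʳ _))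
∑-compositions-suc (suc k) f = begin
  ∑ f (map (1 ∷_) C ++ map incHead C)
    ≡⟨ ∑-++ f (map (1 ∷_) C) (map incHead C) ⟩
  ∑ f (map (1 ∷_) C) + ∑ f (map incHead C)
    ≡⟨ cong₂ _+_ (∑-map f (1 ∷_) C) (∑-map f incHead C) ⟩
  ∑ (λ τ → f (1 ∷ τ)) C + ∑ (f ∘ incHead) C
    ≡⟨ cong (∑ (λ τ → f (1 ∷ τ)) C +_) (∑-compositions-suc k (f ∘ incHead)) ⟩
  ∑< (suc (suc k)) (λ j → ∑ (λ τ → f (suc j ∷ τ)) (compositions (suc k ∸ j))) ∎
  where
  open ≡-Reasoning
  C = compositions (suc k)

shift : (ℕ → ℕ) → ℕ → ℕ → ℕ
shift y s k = y (s + k) ∸ y 1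

shift-nonDecreasing : ∀ {y} → NonDecreasing y → ∀ s → NonDecreasing (shift y s)
shift-nonDecreasing {y} mono s {i} 1≤i i≤j =
  ∸-monoˡ-≤ (y 1) (mono (≤-trans 1≤i (m≤n+m i s)) (+-monoʳ-≤ s i≤j))

Ψ-shift : ∀ {y} → NonDecreasing y → ∀ π t τ i →
  Ψ y (t ∷ τ) π (suc (suc i)) ≡ Ψ (shift y (psum π t)) τ (drop t π) (suc i)
Ψ-shift {y} mono π t τ zero =
  cong (λ k → y k ∸ y 1) (trans (cong (suc ∘ psum π) (+-identityʳ t)) (+-comm 1 (psum π t)))
Ψ-shift {y} mono π t τ (suc i) = begin
  y (suc (psum π (t + r₁))) ∸ y (suc (psum π (t + r₀)))
    ≡⟨ cong₂ (λ a b → y (suc a) ∸ y (suc b)) (psum-+ t r₁ π) (psum-+ t r₀ π) ⟩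
  y (suc (s + psum π′ r₁)) ∸ y (suc (s + psum π′ r₀))
    ≡⟨ cong₂ (λ a b → y a ∸ y b) (sym (+-suc s _)) (sym (+-suc s _)) ⟩
  y (s + suc (psum π′ r₁)) ∸ y (s + suc (psum π′ r₀))
    ≡⟨ ∸-cancel (mono ≤-refl (≤-trans (s≤s z≤n) (m≤n+m (suc (psum π′ r₀)) s))) ⟩
  shift y s (suc (psum π′ r₁)) ∸ shift y s (suc (psum π′ r₀)) ∎
  where
  open ≡-Reasoning
  r₁ = psum τ (suc i)
  r₀ = psum τ i
  s  = psum π t
  π′ = drop t π
  ∸-cancel : ∀ {a b c} → c ≤ b → a ∸ b ≡ (a ∸ c) ∸ (b ∸ c)
  ∸-cancel {a} {b} {c} c≤b =
    trans (cong (a ∸_) (sym (m+[n∸m]≡n c≤b))) (sym (∸-+-assoc a c (b ∸ c)))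

weight : (ℕ → ℕ) → List ℕ → List ℕ → ℕ
weight y π τ = product (map (λ j → Ψ y τ π (suc j) C at τ j) (upTo (length τ)))

weight-∷ : ∀ {y} → NonDecreasing y → ∀ π t τ →
  weight y π (t ∷ τ) ≡ (y 1 C t) * weight (shift y (psum π t)) (drop t π) τ
weight-∷ {y} mono π t τ = cong ((y 1 C t) *_) (cong product (begin
  map (λ j → Ψ y (t ∷ τ) π (suc j) C at (t ∷ τ) j) (applyUpTo suc (length τ))
    ≡⟨ cong (map _) (List.map-upTo suc (length τ)) ⟨
  map (λ j → Ψ y (t ∷ τ) π (suc j) C at (t ∷ τ) j) (map suc (upTo (length τ)))
    ≡⟨ List.map-∘ (upTo (length τ)) ⟨
  map (λ j → Ψ y (t ∷ τ) π (suc (suc j)) C at τ j) (upTo (length τ))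
    ≡⟨ List.map-cong (λ j → cong (_C at τ j) (Ψ-shift mono π t τ j)) (upTo (length τ)) ⟩
  map (λ j → Ψ (shift y (psum π t)) τ (drop t π) (suc j) C at τ j) (upTo (length τ)) ∎))
  where open ≡-Reasoning

γ-∷ : ∀ {y} → NonDecreasing y → ∀ a π →
  γ y (a ∷ π) ≡ ∑< (suc (length π))
                  (λ j → (y 1 C suc j) * γ (shift y (psum (a ∷ π) (suc j))) (drop j π))
γ-∷ {y} mono a π = begin
  ∑ (weight y (a ∷ π)) (compositions (suc k))
    ≡⟨ ∑-compositions-suc k (weight y (a ∷ π)) ⟩
  ∑< (suc k) (λ j → ∑ (λ τ → weight y (a ∷ π) (suc j ∷ τ)) (compositions (k ∸ j)))
    ≡⟨ ∑<-cong (suc k) (λ {j} _ → expand j) ⟩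
  ∑< (suc k) (λ j → (y 1 C suc j) * γ (shift y (psum (a ∷ π) (suc j))) (drop j π)) ∎
  where
  open ≡-Reasoning
  k = length π
  expand : ∀ j → ∑ (λ τ → weight y (a ∷ π) (suc j ∷ τ)) (compositions (k ∸ j))
                 ≡ (y 1 C suc j) * γ (shift y (psum (a ∷ π) (suc j))) (drop j π)
  expand j = begin
    ∑ (λ τ → weight y (a ∷ π) (suc j ∷ τ)) (compositions (k ∸ j))
      ≡⟨ ∑-cong (compositions (k ∸ j)) (weight-∷ mono (a ∷ π) (suc j)) ⟩
    ∑ (λ τ → c * weight y′ (drop j π) τ) (compositions (k ∸ j))
      ≡⟨ ∑-*ˡ c (weight y′ (drop j π)) (compositions (k ∸ j)) ⟩
    c * ∑ (weight y′ (drop j π)) (compositions (k ∸ j))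
      ≡⟨ cong (λ l → c * ∑ (weight y′ (drop j π)) (compositions l)) (sym (List.length-drop j π)) ⟩
    c * γ y′ (drop j π) ∎
    where
    c  = y 1 C suc j
    y′ = shift y (psum (a ∷ π) (suc j))

-- Admissible sequences

-- The condition of PF_N(y) for k = suc j ∈ [1, N].
Good : (ℕ → ℕ) → ℕ → List ℕ → Set
Good y N d = ∀ j → j < N → suc j ≤ psum d (y (suc j))

goodᵇ : (ℕ → ℕ) → ℕ → List ℕ → Bool
goodᵇ y N d = all (λ j → suc j ≤ᵇ psum d (y (suc j))) (upTo N)

T-goodᵇ : ∀ {y N d} → T (goodᵇ y N d) ⇔ Good y N d
T-goodᵇ {y} {N} {d} = mk⇔
  (λ t j j<N → ≤ᵇ⇒≤ _ _ (applyUpTo⁻ id N (all⁺ test (upTo N) t) j<N))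
  (λ g → all⁻ test (applyUpTo⁺₁ id N (λ {j} j<N → ≤⇒≤ᵇ (g j j<N))))
  where
  test : ℕ → Bool
  test j = suc j ≤ᵇ psum d (y (suc j))

good? : ∀ y N d → Dec (Good y N d)
good? y N d = Dec.map (T-goodᵇ {y} {N} {d}) (T? (goodᵇ y N d))

Admissible : (ℕ → ℕ) → List ℕ → List ℕ → Set
Admissible y π d = deleteZeros d ≡ π × Good y (sum π) d

admissible? : ∀ y π d → Dec (Admissible y π d)
admissible? y π d = (deleteZeros d ≟ₗ π) ×-dec good? y (sum π) d

#Admissible : (ℕ → ℕ) → ℕ → List ℕ → ℕ
#Admissible y M π = ∑ (λ d → 𝟙 (admissible? y π d)) (lists (y (sum π)) M)

¬Admissible-shift-0 : ∀ {y π d} → 1 ≤ sum π → ¬ Admissible (shift y 0) π d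
¬Admissible-shift-0 {y} {d = d} 1≤sum (_ , good) =
  1+n≰n (subst (1 ≤_) (cong (psum d) (n∸n≡0 (y 1))) (good 0 1≤sum))

module _ {y : ℕ → ℕ} (mono : NonDecreasing y) {d₁ : List ℕ} (len : length d₁ ≡ y 1) where

  psum-++-y : ∀ d₂ {k} → 1 ≤ k → psum (d₁ ++ d₂) (y k) ≡ sum d₁ + psum d₂ (y k ∸ y 1)
  psum-++-y d₂ {k} 1≤k =
    trans (psum-++ d₁ d₂ (subst (_≤ y k) (sym len) (mono ≤-refl 1≤k)))
          (cong (λ l → sum d₁ + psum d₂ (y k ∸ l)) len)

  Good-++⁻ : ∀ {N d₂} → Good y (sum d₁ + N) (d₁ ++ d₂) → Good (shift y (sum d₁)) N d₂
  Good-++⁻ {N} {d₂} good j j<N = +-cancelˡ-≤ s (suc j) _ (begin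
    s + suc j                            ≡⟨ +-suc s j ⟩
    suc (s + j)                          ≤⟨ good (s + j) (+-monoʳ-< s j<N) ⟩
    psum (d₁ ++ d₂) (y (suc (s + j)))    ≡⟨ psum-++-y d₂ (s≤s z≤n) ⟩
    s + psum d₂ (y (suc (s + j)) ∸ y 1)  ≡⟨ cong (λ k → s + psum d₂ (y k ∸ y 1)) (sym (+-suc s j)) ⟩
    s + psum d₂ (shift y s (suc j))      ∎)
    where
    s = sum d₁
    open ≤-Reasoning

  Good-++⁺ : ∀ {N d₂} → Good (shift y (sum d₁)) N d₂ → Good y (sum d₁ + N) (d₁ ++ d₂)
  Good-++⁺ {N} {d₂} good j j<s+N with j <? sum d₁
  ... | yes j<s = begin
    suc j                        ≤⟨ j<s ⟩
    sum d₁                       ≤⟨ m≤m+n (sum d₁) _ ⟩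
    sum d₁ + psum d₂ (y 1 ∸ y 1) ≡⟨ psum-++-y d₂ ≤-refl ⟨
    psum (d₁ ++ d₂) (y 1)        ≤⟨ psum-mono (d₁ ++ d₂) (mono ≤-refl (s≤s z≤n)) ⟩
    psum (d₁ ++ d₂) (y (suc j))  ∎
    where open ≤-Reasoning
  ... | no j≮s = begin
    suc j                                ≡⟨ s+1+i≡1+j ⟨
    s + suc i                            ≤⟨ +-monoʳ-≤ s (good i i<N) ⟩
    s + psum d₂ (y (s + suc i) ∸ y 1)    ≡⟨ cong (λ k → s + psum d₂ (y k ∸ y 1)) s+1+i≡1+j ⟩
    s + psum d₂ (y (suc j) ∸ y 1)        ≡⟨ psum-++-y d₂ (s≤s z≤n) ⟨
    psum (d₁ ++ d₂) (y (suc j))          ∎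
    where
    open ≤-Reasoning
    s = sum d₁
    i = j ∸ s
    s+i≡j : s + i ≡ j
    s+i≡j = m+[n∸m]≡n (≮⇒≥ j≮s)
    s+1+i≡1+j : s + suc i ≡ suc j
    s+1+i≡1+j = trans (+-suc s i) (cong suc s+i≡j)
    i<N : i < N
    i<N = +-cancelˡ-< s i N (subst (_< s + N) (sym s+i≡j) j<s+N)

  Admissible-++⁻ : ∀ {π d₂} → Admissible y π (d₁ ++ d₂) →
    let t = length (deleteZeros d₁) in
    deleteZeros d₁ ≡ take t π × Admissible (shift y (psum π t)) (drop t π) d₂
  Admissible-++⁻ {π} {d₂} (dz≡π , good) =
    u≡ , v≡ , subst (λ s → Good (shift y s) (sum (drop t π)) d₂) (sum≡psum d₁ u≡) (Good-++⁻ good′)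
    where
    t = length (deleteZeros d₁)
    uv≡π : deleteZeros d₁ ++ deleteZeros d₂ ≡ π
    uv≡π = trans (sym (deleteZeros-++ d₁ d₂)) dz≡π
    u≡ : deleteZeros d₁ ≡ take t π
    u≡ = trans (sym (take-length-++ (deleteZeros d₁) (deleteZeros d₂))) (cong (take t) uv≡π)
    v≡ : deleteZeros d₂ ≡ drop t π
    v≡ = trans (sym (drop-length-++ (deleteZeros d₁) (deleteZeros d₂))) (cong (drop t) uv≡π)
    good′ : Good y (sum d₁ + sum (drop t π)) (d₁ ++ d₂)
    good′ = subst (λ N → Good y N (d₁ ++ d₂))
                  (trans (sum-take-drop t π) (cong (_+ sum (drop t π)) (sym (sum≡psum d₁ u≡)))) good

  Admissible-++⁺ : ∀ {π d₂ t} → deleteZeros d₁ ≡ take t π →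
    Admissible (shift y (psum π t)) (drop t π) d₂ → Admissible y π (d₁ ++ d₂)
  Admissible-++⁺ {π} {d₂} {t} u≡ (v≡ , good) =
    dz≡π , subst (λ N → Good y N (d₁ ++ d₂)) N≡ (Good-++⁺ good′)
    where
    dz≡π : deleteZeros (d₁ ++ d₂) ≡ π
    dz≡π = trans (deleteZeros-++ d₁ d₂) (trans (cong₂ _++_ u≡ v≡) (List.take++drop≡id t π))
    good′ : Good (shift y (sum d₁)) (sum (drop t π)) d₂
    good′ = subst (λ s → Good (shift y s) (sum (drop t π)) d₂) (sym (sum≡psum d₁ u≡)) good
    N≡ : sum d₁ + sum (drop t π) ≡ sum π
    N≡ = trans (cong (_+ _) (sum≡psum d₁ u≡)) (sym (sum-take-drop t π))

  𝟙-admissible-++ : ∀ π d₂ → 𝟙 (admissible? y π (d₁ ++ d₂)) ≡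
    ∑< (suc (length π)) (λ t → 𝟙 (deleteZeros d₁ ≟ₗ take t π)
                              * 𝟙 (admissible? (shift y (psum π t)) (drop t π) d₂))
  𝟙-admissible-++ π d₂ = begin
    𝟙 (admissible? y π (d₁ ++ d₂))
      ≡⟨ 𝟙-cong Admissible-++⁻ (uncurry Admissible-++⁺) _ (u≟ t ×-dec a? t) ⟩
    𝟙 (u≟ t ×-dec a? t)
      ≡⟨ 𝟙-× (u≟ t) (a? t) ⟩
    𝟙 (u≟ t) * 𝟙 (a? t)
      ≡⟨ ∑<-prefixes (deleteZeros d₁) π (λ t → 𝟙 (a? t)) ⟨
    ∑< (suc (length π)) (λ t → 𝟙 (u≟ t) * 𝟙 (a? t)) ∎
    where
    open ≡-Reasoning
    t = length (deleteZeros d₁)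
    u≟ : ∀ t → Dec (deleteZeros d₁ ≡ take t π)
    u≟ t = deleteZeros d₁ ≟ₗ take t π
    a? : ∀ t → Dec (Admissible (shift y (psum π t)) (drop t π) d₂)
    a? t = admissible? (shift y (psum π t)) (drop t π) d₂

#Admissible-split : ∀ {y} M π → NonDecreasing y → Composition≤ M π → 1 ≤ sum π →
  #Admissible y M π ≡ ∑< (suc (length π)) (λ t → (y 1 C t) * #Admissible (shift y (psum π t)) M (drop t π))
#Admissible-split {y} M π mono parts 1≤N = begin
  ∑ (𝟙 ∘ admissible? y π) (lists (y (sum π)) M)
    ≡⟨ cong (λ L → ∑ (𝟙 ∘ admissible? y π) (lists L M)) (sym (m+[n∸m]≡n (mono ≤-refl 1≤N))) ⟩
  ∑ (𝟙 ∘ admissible? y π) (lists (y 1 + B) M)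
    ≡⟨ ∑-lists-+ (y 1) B M _ ⟩
  ∑ (λ d₁ → ∑ (λ d₂ → 𝟙 (admissible? y π (d₁ ++ d₂))) (lists B M)) (lists (y 1) M)
    ≡⟨ ∑-lists-cong (y 1) M (λ d₁ len → ∑-cong (lists B M) (𝟙-admissible-++ mono len π)) ⟩
  ∑ (λ d₁ → ∑ (λ d₂ → ∑< m (λ t → prefix t d₁ * rest t d₂)) (lists B M)) (lists (y 1) M)
    ≡⟨ ∑-cong (lists (y 1) M) (λ d₁ → ∑-∑< m (λ d₂ t → prefix t d₁ * rest t d₂) (lists B M)) ⟩
  ∑ (λ d₁ → ∑< m (λ t → ∑ (λ d₂ → prefix t d₁ * rest t d₂) (lists B M))) (lists (y 1) M)
    ≡⟨ ∑-∑< m (λ d₁ t → ∑ (λ d₂ → prefix t d₁ * rest t d₂) (lists B M)) (lists (y 1) M) ⟩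
  ∑< m (λ t → ∑ (λ d₁ → ∑ (λ d₂ → prefix t d₁ * rest t d₂) (lists B M)) (lists (y 1) M))
    ≡⟨ ∑<-cong m (λ {t} t<m → trans (∑-∑-* (lists (y 1) M) (lists B M))
                                     (cong₂ _*_ (count-prefix t<m) (count-rest t))) ⟩
  ∑< m (λ t → (y 1 C t) * #Admissible (shift y (psum π t)) M (drop t π)) ∎
  where
  open ≡-Reasoning
  m = suc (length π)
  B = y (sum π) ∸ y 1
  prefix : ℕ → List ℕ → ℕ
  prefix t d₁ = 𝟙 (deleteZeros d₁ ≟ₗ take t π)
  rest : ℕ → List ℕ → ℕ
  rest t d₂ = 𝟙 (admissible? (shift y (psum π t)) (drop t π) d₂)
  count-prefix : ∀ {t} → t < m → ∑ (prefix t) (lists (y 1) M) ≡ y 1 C t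
  count-prefix {t} t<m = trans (∑-lists-deleteZeros (y 1) M (take t π) (take⁺ t parts))
                          (cong (y 1 C_) (length-take-≤ π (s≤s⁻¹ t<m)))
  count-rest : ∀ t → ∑ (rest t) (lists B M) ≡ #Admissible (shift y (psum π t)) M (drop t π)
  count-rest t = cong (λ k → ∑ (rest t) (lists (y k ∸ y 1) M)) (sum-take-drop t π)

#Admissible≡γ : ∀ fuel {y} M π → length π ≤ fuel → NonDecreasing y → Composition≤ M π →
  #Admissible y M π ≡ γ y π
#Admissible≡γ _ {y} M [] _ _ _ =
  trans (∑-cong (lists (y 0) M) (λ d → 𝟙-cong proj₁ (_, λ _ ()) _ _)) (∑-lists-deleteZeros (y 0) M [] [])
#Admissible≡γ (suc fuel) {y} M π@(a ∷ π₀) (s≤s len≤) mono parts@((1≤a , _) ∷ _) = begin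
  #Admissible y M π
    ≡⟨ #Admissible-split M π mono parts 1≤N ⟩
  (y 1 C 0) * #Admissible (shift y 0) M π
    + ∑< (suc (length π₀)) (λ j → (y 1 C suc j) * #Admissible (shift y (psum π (suc j))) M (drop j π₀))
    ≡⟨ cong₂ _+_ (trans (cong ((y 1 C 0) *_) no-empty-prefix) (*-zeroʳ (y 1 C 0)))
                 (∑<-cong (suc (length π₀)) (λ {j} _ → cong ((y 1 C suc j) *_) (IH j))) ⟩
  ∑< (suc (length π₀)) (λ j → (y 1 C suc j) * γ (shift y (psum π (suc j))) (drop j π₀))
    ≡⟨ γ-∷ mono a π₀ ⟨
  γ y π ∎
  where
  open ≡-Reasoning
  1≤N : 1 ≤ sum π
  1≤N = ≤-trans 1≤a (m≤m+n a _)
  no-empty-prefix : #Admissible (shift y 0) M π ≡ 0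
  no-empty-prefix = ∑-0 (lists (shift y 0 (sum π)) M)
    (λ d → 𝟙-¬ (¬Admissible-shift-0 {y} {π} {d} 1≤N) (admissible? (shift y 0) π d))
  IH : ∀ j → #Admissible (shift y (psum π (suc j))) M (drop j π₀)
           ≡ γ (shift y (psum π (suc j))) (drop j π₀)
  IH j = #Admissible≡γ fuel M (drop j π₀)
           (≤-trans (≤-reflexive (List.length-drop j π₀)) (≤-trans (m∸n≤m _ j) len≤))
           (shift-nonDecreasing mono _) (drop⁺ (suc j) parts)

chPF-predicate⇒ : ∀ x n π d → T (admissible x n d ∧ ⌊ deleteZeros d ≟ₗ π ⌋) →
  sum π ≡ n × Admissible x π d
chPF-predicate⇒ x n π d t with Equivalence.to T-∧ t
... | adm , dz with Equivalence.to (T-∧ {sum d ≡ᵇ n}) adm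
... | sum≡ᵇ , good =
  sum≡n , dz≡π , subst (λ N → Good x N d) (sym sum≡n) (Equivalence.to (T-goodᵇ {x} {n} {d}) good)
  where
  dz≡π = toWitness dz
  sum≡n = trans (trans (cong sum (sym dz≡π)) (sum-deleteZeros d)) (≡ᵇ⇒≡ _ _ sum≡ᵇ)

chPF-predicate⇐ : ∀ x π d → Admissible x π d →
  T (admissible x (sum π) d ∧ ⌊ deleteZeros d ≟ₗ π ⌋)
chPF-predicate⇐ x π d (dz≡π , good) = Equivalence.from T-∧
  ( Equivalence.from T-∧ ( ≡⇒≡ᵇ _ _ (trans (sym (sum-deleteZeros d)) (cong sum dz≡π))
                         , Equivalence.from (T-goodᵇ {x} {sum π} {d}) good)
  , fromWitness dz≡π)

chPF≡#Admissible : ∀ x π → chPF x (sum π) π ≡ #Admissible x (sum π) π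
chPF≡#Admissible x π = trans (count≡∑𝟙 _ (lists (x (sum π)) (sum π)))
  (∑-cong (lists (x (sum π)) (sum π)) λ d →
    𝟙-cong (proj₂ ∘ chPF-predicate⇒ x (sum π) π d) (chPF-predicate⇐ x π d) _ (admissible? x π d))

chPF≡0 : ∀ x n π → sum π ≢ n → chPF x n π ≡ 0
chPF≡0 x n π sum≢n = trans (count≡∑𝟙 _ (lists (x n) n))
  (∑-0 (lists (x n) n) (λ d → 𝟙-¬ (sum≢n ∘ proj₁ ∘ chPF-predicate⇒ x n π d) _))

composition≤sum : ∀ {π} → All (1 ≤_) π → Composition≤ (sum π) π
composition≤sum []                 = []
composition≤sum {a ∷ π} (1≤a ∷ ps) =
  (1≤a , m≤m+n a (sum π)) ∷ All.map (λ (p , q) → p , ≤-trans q (m≤n+m (sum π) a)) (composition≤sum ps)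

chPF≡γ : ∀ {x π} → NonDecreasing x → All (1 ≤_) π → chPF x (sum π) π ≡ γ x π
chPF≡γ {x} {π} mono pos = trans (chPF≡#Admissible x π)
  (#Admissible≡γ (length π) (sum π) π ≤-refl mono (composition≤sum pos))

-- The identity also holds for n = 0.
theorem2 : (x : ℕ → ℕ) → NonDecreasing x → (n : ℕ) → 1 ≤ n →
  (π : List ℕ) → All (1 ≤_) π → chPF x n π ≡ rhs x n π
theorem2 x mono n _ π pos with sum π ≡ᵇ n in eq
... | true  = subst (λ m → chPF x m π ≡ γ x π) (≡ᵇ⇒≡ _ _ (subst T (sym eq) tt)) (chPF≡γ mono pos)
... | false = chPF≡0 x n π (λ sum≡n → subst T eq (≡⇒≡ᵇ _ _ sum≡n))
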